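{- Let $A$, $B$, $C$ be finite $\sigma$-structures and $k\ge 1$; let $S$ be a flasque subpresheaf of $H_k(A,B)$ and $T$ a flasque subpresheaf of $H_k(B,C)$. If $S^{\Box} = S$ and $T^{\Box} = T$, then $(T \circ S)^{\Box} = T\circ S$.
   Context: $\sigma$ is a finite relational vocabulary; structures are identified with universes. For structures $X, Y$: $S_k(X)$ is the poset of subsets of $X$ of size at most $k$ (induced substructures), $M_k(X)$ its set of maximal elements; $H_k(X,Y) : S_k(X)^{op}\to\mathbf{Set}$ sends $D$ to the set of homomorphisms $D\to Y$, with restriction maps $\rho^D_{D'}(h) = h|_{D'}$. A subpresheaf is flasque if its restriction maps are surjective. The composite $T \circ S$ is the subpresheaf of $H_k(A,C)$ with $(T\circ S)(U) = \{t \circ s : s \in S(U),\ t \in T(\operatorname{im} s)\}$. For a set $X$, $\mathbb{Z}^{(X)}$ is the free abelian group on $X$ and for $f : X \to Y$, $\mathbb{Z}^{(f)}(\sum r_i x_i) = \sum r_i f(x_i)$. For a subpresheaf $P$ of $H_k(X,Y)$ and $p \in P(D_0)$ with $D_0 \in M_k(X)$, $\mathbb{Z}\text{ -test}(P,p)$ holds iff there is a family $\{\alpha_D\}_{D\in M_k(X)}$, $\alpha_D \in \mathbb{Z}^{(P(D))}$, with $\mathbb{Z}^{(\rho^D_{D\cap D'})}(\alpha_D) = \mathbb{Z}^{(\rho^{D'}_{D\cap D'})}(\alpha_{D'})$ for all $D, D' \in M_k(X)$ and $\alpha_{D_0} = 1\cdot p$. Then $P^{\Box}$ is the subpresheaf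 with $P^{\Box}(D) = \{p \in P(D) : \mathbb{Z}\text{ -test}(P,p)\}$ for $D \in M_k(X)$ and $P^{\Box}(D) = P(D)$ otherwise. -}

module Defs where

open import Data.Nat using (ℕ; zero; suc; _≤_)
open import Data.Integer using (ℤ; _+_; 0ℤ; 1ℤ)
open import Data.Bool using (Bool; true; false; if_then_else_)
open import Data.Fin using (Fin)
open import Data.Fin.Subset using (Subset; _∈_; _∉_; _⊆_; _∩_; ∣_∣)
open import Data.Maybe using (Maybe; just; nothing; _>>=_)
open import Data.List using (List; []; _∷_; map; foldr; concatMap; allFin)
open import Data.Bool.ListAction using (any)
open import Data.Vec using (Vec; []; _∷_; lookup; zipWith; tabulate; map)
import Data.Vec.Properties as VecP
import Data.Maybe.Properties as MaybeP
import Data.Fin.Properties as FinP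
open import Data.Product using (Σ; ∃; _×_; _,_)
open import Relation.Nullary using (¬_)
open import Relation.Nullary.Decidable using (⌊_⌋)
open import Relation.Binary.PropositionalEquality using (_≡_)

record Vocab : Set where
  field
    nrel  : ℕ
    arity : Fin nrel → ℕ
open Vocab public

record Struct (σ : Vocab) : Set where
  field
    size : ℕ
    rel  : (R : Fin (nrel σ)) → (Fin (arity σ R) → Fin size) → Bool
open Struct public

-- Partial maps X ⇀ Y, represented as vectors of Maybe.  A map with
-- domain D : Subset (size X) is `just` exactly on D.  This gives a
-- canonical representation with decidable equality.

PMap : ℕ → ℕ → Set
PMap m m' = Vec (Maybe (Fin m')) m

_≟P_ : ∀ {m m'} (h g : PMap m m') → _
_≟P_ = VecP.≡-dec (MaybeP.≡-dec FinP._≟_)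

HasDom : ∀ {m m'} → Subset m → PMap m m' → Set
HasDom D h = ∀ x → (x ∈ D → ∃ λ y → lookup h x ≡ just y)
                 × (x ∉ D → lookup h x ≡ nothing)

IsHomOn : ∀ {σ} (X Y : Struct σ) → Subset (size X) → PMap (size X) (size Y) → Set
IsHomOn {σ} X Y D h =
  HasDom D h ×
  (∀ (R : Fin (nrel σ)) (t : Fin (arity σ R) → Fin (size X))
     (t' : Fin (arity σ R) → Fin (size Y)) →
     (∀ i → lookup h (t i) ≡ just (t' i)) →
     rel X R t ≡ true → rel Y R t' ≡ true)

restrict : ∀ {m m'} → Subset m → PMap m m' → PMap m m'
restrict E h = zipWith (λ b y → if b then y else nothing) E h

compose : ∀ {a b c} → PMap b c → PMap a b → PMap a c
compose t s = Data.Vec.map (λ y → y >>= lookup t) s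

image : ∀ {a b} → PMap a b → Subset b
image {a} s = tabulate λ y →
  any (λ x → ⌊ MaybeP.≡-dec FinP._≟_ (lookup s x) (just y) ⌋) (allFin a)

-- Enumeration of all partial maps (each exactly once), used to define
-- the pushforward Z^(ρ) on finitely supported formal sums.

allVecs : ∀ {A : Set} → List A → (n : ℕ) → List (Vec A n)
allVecs xs zero    = [] ∷ []
allVecs xs (suc n) = concatMap (λ x → Data.List.map (x ∷_) (allVecs xs n)) xs

allPMaps : (m m' : ℕ) → List (PMap m m')
allPMaps m m' = allVecs (nothing ∷ Data.List.map just (allFin m')) m

sumℤ : List ℤ → ℤ
sumℤ = foldr _+_ 0ℤ

-- Elements of Z^(PMap) are functions PMap → ℤ (PMap is finite).
-- Pushforward along restriction to E:  Z^(ρ_E)(α)(g) = Σ_{h, h|E = g} α(h)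
pushRestrict : ∀ {m m'} → Subset m → (PMap m m' → ℤ) → PMap m m' → ℤ
pushRestrict {m} {m'} E α g =
  sumℤ (Data.List.map (λ h → if ⌊ restrict E h ≟P g ⌋ then α h else 0ℤ)
                      (allPMaps m m'))

Family : ∀ {σ} (X Y : Struct σ) → Set₁
Family X Y = Subset (size X) → PMap (size X) (size Y) → Set

IsSubpresheaf : ∀ {σ} (k : ℕ) (X Y : Struct σ) → Family X Y → Set
IsSubpresheaf k X Y P =
  (∀ D h → P D h → ∣ D ∣ ≤ k × IsHomOn X Y D h) ×
  (∀ D D' h → D' ⊆ D → P D h → P D' (restrict D' h))

IsFlasque : ∀ {σ} (k : ℕ) (X Y : Struct σ) → Family X Y → Set
IsFlasque k X Y P =
  ∀ D D' → ∣ D ∣ ≤ k → D' ⊆ D → ∀ h' → P D' h' →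
    ∃ λ h → P D h × restrict D' h ≡ h'

IsMaxₖ : ∀ {n} (k : ℕ) → Subset n → Set
IsMaxₖ k D = ∣ D ∣ ≤ k × (∀ E → ∣ E ∣ ≤ k → D ⊆ E → E ≡ D)

ZTest : ∀ {σ} (k : ℕ) (X Y : Struct σ) → Family X Y →
        Subset (size X) → PMap (size X) (size Y) → Set
ZTest k X Y P D₀ p =
  Σ (Subset (size X) → PMap (size X) (size Y) → ℤ) λ α →
    (∀ D → IsMaxₖ k D → ∀ h → ¬ (α D h ≡ 0ℤ) → P D h) ×
    (∀ D D' → IsMaxₖ k D → IsMaxₖ k D' → ∀ g →
       pushRestrict (D ∩ D') (α D) g ≡ pushRestrict (D ∩ D') (α D') g) ×
    (α D₀ p ≡ 1ℤ) × (∀ h → ¬ (h ≡ p) → α D₀ h ≡ 0ℤ)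

Box : ∀ {σ} (k : ℕ) (X Y : Struct σ) → Family X Y → Family X Y
Box k X Y P D h = P D h × (IsMaxₖ k D → ZTest k X Y P D h)

Comp : ∀ {σ} {A B C : Struct σ} → Family B C → Family A B → Family A C
Comp T S U h = ∃ λ s → ∃ λ t → S U s × T (image s) t × h ≡ compose t s

SameFamily : ∀ {σ} (X Y : Struct σ) → Family X Y → Family X Y → Set
SameFamily X Y P Q = ∀ D h → (P D h → Q D h) × (Q D h → P D h)

-- Let h = t ∘ s lie in (T ∘ S)(U) with U maximal.  S^□ = S gives a Z-test witness α for s.
-- As T is flasque, t extends to some t′ on a maximal D ⊇ im s, and T^□ = T gives a witness β
-- for t′.  By compatibility, the restriction of β_D to a set F of size ≤ k does not depend on
-- the maximal D ⊇ F; call it β̂_F.  The witness for h is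
--   γ_D = Σ_{s′} α_D(s′) · ℤ^(u ↦ u ∘ s′)(β̂_{im s′}).
-- Restriction commutes with this construction, since ρ_E(u ∘ s′) = ρ_F(u) ∘ ρ_E(s′) for
-- F = im ρ_E(s′), so γ inherits compatibility from α; its support lies in T ∘ S because those
-- of α and β lie in S and T; and at U it is the unit vector at ρ_{im s}(t′) ∘ s = t ∘ s.

module Submission where

open import Defs
open import Data.Nat as ℕ using (ℕ; zero; suc; _≤_; _∸_; z≤n; s≤s)
import Data.Nat.Properties as ℕP
open import Data.Integer using (ℤ; 0ℤ; 1ℤ; _+_; _*_)
import Data.Integer.Properties as ℤP
open import Algebra.Properties.CommutativeSemigroup ℤP.+-commutativeSemigroup using (interchange)
open import Data.Bool using (Bool; true; false; if_then_else_; _∨_)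
open import Data.Fin as Fin using (Fin)
import Data.Fin.Properties as FinP
open import Data.Maybe using (Maybe; just; nothing)
import Data.Maybe.Properties as MaybeP
open import Data.List as List using (List; []; _∷_; _++_; concatMap; allFin)
import Data.List.Properties as ListP
open import Data.Vec using (Vec; []; _∷_; lookup; tabulate; here; there)
open import Data.Fin.Subset using (Subset; _∈_; _∉_; _⊆_; _∩_; _∪_; ∣_∣; ⁅_⁆; ⊥; ⊤)
import Data.Fin.Subset.Properties as SubsetP
open import Data.Bool.ListAction using (or)
import Data.Bool.Properties as BoolP
import Data.Vec.Properties as VecP
open import Data.Product using (∃; _×_; _,_; proj₁; proj₂)
open import Data.Sum using (_⊎_; inj₁; inj₂)
open import Data.Empty using (⊥-elim)
open import Function using (_∘_; id)
open import Function.Definitions using (Injective)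
open import Relation.Nullary using (¬_; yes; no)
open import Relation.Nullary.Decidable using (⌊_⌋)
open import Relation.Binary.Definitions using (DecidableEquality)
open import Relation.Binary.PropositionalEquality

∑ : {A : Set} → List A → (A → ℤ) → ℤ
∑ xs f = sumℤ (List.map f xs)

module _ {A : Set} where

  ∑-cong : ∀ xs {f g : A → ℤ} → f ≗ g → ∑ xs f ≡ ∑ xs g
  ∑-cong []       f≗g = refl
  ∑-cong (x ∷ xs) f≗g = cong₂ _+_ (f≗g x) (∑-cong xs f≗g)

  ∑-zero : ∀ (xs : List A) → ∑ xs (λ _ → 0ℤ) ≡ 0ℤ
  ∑-zero []       = refl
  ∑-zero (x ∷ xs) = trans (ℤP.+-identityˡ _) (∑-zero xs)

  ∑-distrib-+ : ∀ xs (f g : A → ℤ) → ∑ xs (λ x → f x + g x) ≡ ∑ xs f + ∑ xs g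
  ∑-distrib-+ []       f g = refl
  ∑-distrib-+ (x ∷ xs) f g =
    trans (cong (f x + g x +_) (∑-distrib-+ xs f g)) (interchange (f x) (g x) _ _)

  ∑-distribˡ : ∀ xs c (f : A → ℤ) → ∑ xs (λ x → c * f x) ≡ c * ∑ xs f
  ∑-distribˡ []       c f = sym (ℤP.*-zeroʳ c)
  ∑-distribˡ (x ∷ xs) c f =
    trans (cong (c * f x +_) (∑-distribˡ xs c f)) (sym (ℤP.*-distribˡ-+ c (f x) _))

  ∑-distribʳ : ∀ xs c (f : A → ℤ) → ∑ xs (λ x → f x * c) ≡ ∑ xs f * c
  ∑-distribʳ xs c f = begin
    ∑ xs (λ x → f x * c) ≡⟨ ∑-cong xs (λ x → ℤP.*-comm (f x) c) ⟩
    ∑ xs (λ x → c * f x) ≡⟨ ∑-distribˡ xs c f ⟩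
    c * ∑ xs f           ≡⟨ ℤP.*-comm c _ ⟩
    ∑ xs f * c           ∎
    where open ≡-Reasoning

  ∑-++ : ∀ xs ys (f : A → ℤ) → ∑ (xs ++ ys) f ≡ ∑ xs f + ∑ ys f
  ∑-++ []       ys f = sym (ℤP.+-identityˡ _)
  ∑-++ (x ∷ xs) ys f = trans (cong (f x +_) (∑-++ xs ys f)) (sym (ℤP.+-assoc (f x) _ _))

  ∑-nonzero : ∀ xs (f : A → ℤ) → ¬ ∑ xs f ≡ 0ℤ → ∃ λ x → ¬ f x ≡ 0ℤ
  ∑-nonzero []       f ∑≢0 = ⊥-elim (∑≢0 refl)
  ∑-nonzero (x ∷ xs) f ∑≢0 with f x ℤP.≟ 0ℤ
  ... | no  fx≢0 = x , fx≢0
  ... | yes fx≡0 = ∑-nonzero xs f λ ∑xs≡0 → ∑≢0 (cong₂ _+_ fx≡0 ∑xs≡0)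

module _ {A B : Set} where

  ∑-map : ∀ (g : A → B) xs (f : B → ℤ) → ∑ (List.map g xs) f ≡ ∑ xs (f ∘ g)
  ∑-map g []       f = refl
  ∑-map g (x ∷ xs) f = cong (f (g x) +_) (∑-map g xs f)

  ∑-concatMap : ∀ (g : A → List B) xs (f : B → ℤ) →
                ∑ (concatMap g xs) f ≡ ∑ xs (λ x → ∑ (g x) f)
  ∑-concatMap g []       f = refl
  ∑-concatMap g (x ∷ xs) f =
    trans (∑-++ (g x) (concatMap g xs) f) (cong (∑ (g x) f +_) (∑-concatMap g xs f))

  ∑-comm : ∀ xs ys (f : A → B → ℤ) →
           ∑ xs (λ x → ∑ ys (f x)) ≡ ∑ ys (λ y → ∑ xs (λ x → f x y))
  ∑-comm []       ys f = sym (∑-zero ys)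
  ∑-comm (x ∷ xs) ys f =
    trans (cong (∑ ys (f x) +_) (∑-comm xs ys f)) (sym (∑-distrib-+ ys (f x) _))

*-nonzero⁻ : ∀ a b → ¬ a * b ≡ 0ℤ → ¬ a ≡ 0ℤ × ¬ b ≡ 0ℤ
*-nonzero⁻ a b ab≢0 = (λ a≡0 → ab≢0 (cong (_* b) a≡0))
                    , (λ b≡0 → ab≢0 (trans (cong (a *_) b≡0) (ℤP.*-zeroʳ a)))

module Indicator {A : Set} (_≟_ : DecidableEquality A) where

  δ : A → A → ℤ
  δ x y = if ⌊ x ≟ y ⌋ then 1ℤ else 0ℤ

  δ-≡ : ∀ {x y} → x ≡ y → δ x y ≡ 1ℤ
  δ-≡ {x} {y} x≡y with x ≟ y
  ... | yes _   = refl
  ... | no  x≢y = ⊥-elim (x≢y x≡y)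

  δ-≢ : ∀ {x y} → ¬ x ≡ y → δ x y ≡ 0ℤ
  δ-≢ {x} {y} x≢y with x ≟ y
  ... | yes x≡y = ⊥-elim (x≢y x≡y)
  ... | no  _   = refl

  δ-nonzero⇒≡ : ∀ {x y} → ¬ δ x y ≡ 0ℤ → x ≡ y
  δ-nonzero⇒≡ {x} {y} δ≢0 with x ≟ y
  ... | yes x≡y = x≡y
  ... | no  _   = ⊥-elim (δ≢0 refl)

  if-≟-δ : ∀ x y c → (if ⌊ x ≟ y ⌋ then c else 0ℤ) ≡ c * δ x y
  if-≟-δ x y c with x ≟ y
  ... | yes _ = sym (ℤP.*-identityʳ c)
  ... | no  _ = sym (ℤP.*-zeroʳ c)

  δ-select : ∀ x y (φ : A → ℤ) → δ x y * φ y ≡ δ x y * φ x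
  δ-select x y φ with x ≟ y
  ... | yes refl = refl
  ... | no  _    = refl

δ-∘-injective : ∀ {A B : Set} (_≟ᴬ_ : DecidableEquality A) (_≟ᴮ_ : DecidableEquality B)
              {f : A → B} → Injective _≡_ _≡_ f →
              ∀ x y → Indicator.δ _≟ᴮ_ (f x) (f y) ≡ Indicator.δ _≟ᴬ_ x y
δ-∘-injective _≟ᴬ_ _≟ᴮ_ {f} f-inj x y with x ≟ᴬ y
... | yes x≡y = Indicator.δ-≡ _≟ᴮ_ (cong f x≡y)
... | no  x≢y = Indicator.δ-≢ _≟ᴮ_ (x≢y ∘ f-inj)

record Enumeration (A : Set) : Set where
  field
    _≟_         : DecidableEquality A
    elements    : List A
    occurs-once : ∀ x → ∑ elements (Indicator.δ _≟_ x) ≡ 1ℤ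

open Enumeration {{...}} public

module _ {A B : Set} (E : Enumeration A) (_≟ᴮ_ : DecidableEquality B)
         (z : B) (f : A → B) (f-injective : Injective _≡_ _≡_ f) (f≢z : ∀ x → ¬ f x ≡ z)
         where
  open Indicator _≟ᴮ_

  occurs-once-∷-map : (∀ y → y ≡ z ⊎ ∃ λ x → f x ≡ y) →
                      ∀ y → ∑ (z ∷ List.map f (elements {{E}})) (δ y) ≡ 1ℤ
  occurs-once-∷-map cover y with cover y
  ... | inj₁ refl = begin
    δ z z + ∑ (List.map f xs) (δ z) ≡⟨ cong₂ _+_ (δ-≡ refl) (∑-map f xs (δ z)) ⟩
    1ℤ + ∑ xs (δ z ∘ f)             ≡⟨ cong (1ℤ +_) (∑-cong xs (λ x → δ-≢ (f≢z x ∘ sym))) ⟩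
    1ℤ + ∑ xs (λ _ → 0ℤ)            ≡⟨ cong (1ℤ +_) (∑-zero xs) ⟩
    1ℤ                              ∎
    where open ≡-Reasoning; xs : List A; xs = elements {{E}}
  ... | inj₂ (x , refl) = begin
    δ (f x) z + ∑ (List.map f xs) (δ (f x)) ≡⟨ cong₂ _+_ (δ-≢ (f≢z x)) (∑-map f xs (δ (f x))) ⟩
    0ℤ + ∑ xs (δ (f x) ∘ f)                 ≡⟨ ℤP.+-identityˡ _ ⟩
    ∑ xs (δ (f x) ∘ f)                      ≡⟨ ∑-cong xs (δ-∘-injective (_≟_ {{E}}) _≟ᴮ_ f-injective x) ⟩
    ∑ xs (Indicator.δ (_≟_ {{E}}) x)        ≡⟨ occurs-once {{E}} x ⟩
    1ℤ                                      ∎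
    where open ≡-Reasoning; xs : List A; xs = elements {{E}}

allFin-occurs-once : ∀ n (i : Fin n) → ∑ (allFin n) (Indicator.δ FinP._≟_ i) ≡ 1ℤ
allFin-occurs-once (suc n) i =
  trans (cong (λ xs → ∑ (Fin.zero ∷ xs) (Indicator.δ FinP._≟_ i))
              (sym (ListP.map-tabulate id Fin.suc)))
        (occurs-once-∷-map Fin-n FinP._≟_ Fin.zero Fin.suc FinP.suc-injective (λ _ ()) cover i)
  where
  Fin-n : Enumeration (Fin n)
  Fin-n = record { _≟_ = FinP._≟_ ; elements = allFin n ; occurs-once = allFin-occurs-once n }

  cover : ∀ (j : Fin (suc n)) → j ≡ Fin.zero ⊎ ∃ λ j′ → Fin.suc j′ ≡ j
  cover Fin.zero    = inj₁ refl
  cover (Fin.suc j) = inj₂ (j , refl)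

instance
  Fin-enumeration : ∀ {n} → Enumeration (Fin n)
  Fin-enumeration {n} = record
    { _≟_ = FinP._≟_ ; elements = allFin n ; occurs-once = allFin-occurs-once n }

  Maybe-enumeration : ∀ {A} → {{Enumeration A}} → Enumeration (Maybe A)
  Maybe-enumeration {A} {{E}} = record
    { _≟_ = MaybeP.≡-dec _≟_ ; elements = nothing ∷ List.map just elements
    ; occurs-once = occurs-once-∷-map E (MaybeP.≡-dec _≟_) nothing just
                      MaybeP.just-injective (λ _ ()) cover }
    where
    cover : ∀ (y : Maybe A) → y ≡ nothing ⊎ ∃ λ x → just x ≡ y
    cover nothing  = inj₁ refl
    cover (just x) = inj₂ (x , refl)

  Vec-enumeration : ∀ {A n} → {{Enumeration A}} → Enumeration (Vec A n)
  Vec-enumeration {A} {n} {{E}} = record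
    { _≟_ = VecP.≡-dec _≟_ ; elements = allVecs elementsᴬ n ; occurs-once = once n }
    where
    elementsᴬ : List A
    elementsᴬ = Enumeration.elements E
    module Iᴬ = Indicator (_≟_ {A = A})
    module Iⱽ {n} = Indicator (VecP.≡-dec {n = n} (_≟_ {A = A}))

    δ-∷ : ∀ {n} x (xs : Vec A n) y ys → Iⱽ.δ (x ∷ xs) (y ∷ ys) ≡ Iᴬ.δ x y * Iⱽ.δ xs ys
    δ-∷ x xs y ys with x ≟ y | VecP.≡-dec _≟_ xs ys
    ... | yes refl | yes refl = refl
    ... | yes refl | no  _    = refl
    ... | no  _    | _        = refl

    once : ∀ n (xs : Vec A n) → ∑ (allVecs elementsᴬ n) (Iⱽ.δ xs) ≡ 1ℤ
    once zero    []       = refl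
    once (suc n) (x ∷ xs) = begin
      ∑ (concatMap (λ y → List.map (y ∷_) (allVecs elementsᴬ n)) elementsᴬ) (Iⱽ.δ (x ∷ xs))
        ≡⟨ ∑-concatMap _ elementsᴬ _ ⟩
      ∑ elementsᴬ (λ y → ∑ (List.map (y ∷_) (allVecs elementsᴬ n)) (Iⱽ.δ (x ∷ xs)))
        ≡⟨ ∑-cong elementsᴬ row ⟩
      ∑ elementsᴬ (λ y → Iᴬ.δ x y * 1ℤ)
        ≡⟨ ∑-distribʳ elementsᴬ 1ℤ (Iᴬ.δ x) ⟩
      ∑ elementsᴬ (Iᴬ.δ x) * 1ℤ
        ≡⟨ cong (_* 1ℤ) (occurs-once x) ⟩
      1ℤ ∎
      where
      open ≡-Reasoning
      row : ∀ y → ∑ (List.map (y ∷_) (allVecs elementsᴬ n)) (Iⱽ.δ (x ∷ xs)) ≡ Iᴬ.δ x y * 1ℤ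
      row y = begin
        ∑ (List.map (y ∷_) (allVecs elementsᴬ n)) (Iⱽ.δ (x ∷ xs))
          ≡⟨ ∑-map (y ∷_) (allVecs elementsᴬ n) _ ⟩
        ∑ (allVecs elementsᴬ n) (λ ys → Iⱽ.δ (x ∷ xs) (y ∷ ys))
          ≡⟨ ∑-cong (allVecs elementsᴬ n) (δ-∷ x xs y) ⟩
        ∑ (allVecs elementsᴬ n) (λ ys → Iᴬ.δ x y * Iⱽ.δ xs ys)
          ≡⟨ ∑-distribˡ (allVecs elementsᴬ n) (Iᴬ.δ x y) (Iⱽ.δ xs) ⟩
        Iᴬ.δ x y * ∑ (allVecs elementsᴬ n) (Iⱽ.δ xs)
          ≡⟨ cong (Iᴬ.δ x y *_) (once n xs) ⟩
        Iᴬ.δ x y * 1ℤ ∎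

module _ {A : Set} {{E : Enumeration A}} where
  open Indicator (_≟_ {{E}}) public

IsUnitAt : ∀ {A : Set} → (A → ℤ) → A → Set
IsUnitAt f p = f p ≡ 1ℤ × (∀ x → ¬ x ≡ p → f x ≡ 0ℤ)

IsUnitAt⇒≗-δ : ∀ {A : Set} {{_ : Enumeration A}} (f : A → ℤ) {p} → IsUnitAt f p → f ≗ δ p
IsUnitAt⇒≗-δ f {p} (fp≡1 , f≡0) x with x ≟ p
... | yes refl = trans fp≡1 (sym (δ-≡ refl))
... | no  x≢p  = trans (f≡0 x x≢p) (sym (δ-≢ (x≢p ∘ sym)))

≗-δ⇒IsUnitAt : ∀ {A : Set} {{_ : Enumeration A}} {f : A → ℤ} {p} → f ≗ δ p → IsUnitAt f p
≗-δ⇒IsUnitAt f≗δ = trans (f≗δ _) (δ-≡ refl) , λ x x≢p → trans (f≗δ x) (δ-≢ (x≢p ∘ sym))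

module _ {A B : Set} {{_ : Enumeration A}} where

  bind : (A → ℤ) → (A → B → ℤ) → B → ℤ
  bind α κ y = ∑ elements (λ x → α x * κ x y)

  bind-δ : ∀ a (κ : A → B → ℤ) → bind (δ a) κ ≗ κ a
  bind-δ a κ y = begin
    ∑ elements (λ x → δ a x * κ x y) ≡⟨ ∑-cong elements (λ x → δ-select a x (λ x → κ x y)) ⟩
    ∑ elements (λ x → δ a x * κ a y) ≡⟨ ∑-distribʳ elements (κ a y) (δ a) ⟩
    ∑ elements (δ a) * κ a y         ≡⟨ cong (_* κ a y) (occurs-once a) ⟩
    1ℤ * κ a y                       ≡⟨ ℤP.*-identityˡ (κ a y) ⟩
    κ a y                            ∎
    where open ≡-Reasoning

  bind-congˡ : ∀ {α α′ : A → ℤ} (κ : A → B → ℤ) → α ≗ α′ → bind α κ ≗ bind α′ κ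
  bind-congˡ κ α≗α′ y = ∑-cong elements (λ x → cong (_* κ x y) (α≗α′ x))

  bind-congʳ : ∀ (α : A → ℤ) {κ κ′ : A → B → ℤ} →
               (∀ x → ¬ α x ≡ 0ℤ → κ x ≗ κ′ x) → bind α κ ≗ bind α κ′
  bind-congʳ α {κ} {κ′} κ≗κ′ y = ∑-cong elements term
    where
    term : ∀ x → α x * κ x y ≡ α x * κ′ x y
    term x with α x ℤP.≟ 0ℤ
    ... | yes αx≡0 = trans (cong (_* κ x y) αx≡0) (sym (cong (_* κ′ x y) αx≡0))
    ... | no  αx≢0 = cong (α x *_) (κ≗κ′ x αx≢0 y)

  bind-support : ∀ α (κ : A → B → ℤ) y → ¬ bind α κ y ≡ 0ℤ →
                 ∃ λ x → ¬ α x ≡ 0ℤ × ¬ κ x y ≡ 0ℤ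
  bind-support α κ y bind≢0 with ∑-nonzero elements _ bind≢0
  ... | x , term≢0 = x , *-nonzero⁻ (α x) (κ x y) term≢0

bind-assoc : ∀ {A B C : Set} {{EA : Enumeration A}} {{EB : Enumeration B}}
             (α : A → ℤ) (κ : A → B → ℤ) (μ : B → C → ℤ) →
             bind (bind α κ) μ ≗ bind α (λ x → bind (κ x) μ)
bind-assoc {A} {B} {{EA}} {{EB}} α κ μ z = begin
  ∑ ys (λ y → ∑ xs (λ x → α x * κ x y) * μ y z)
    ≡⟨ ∑-cong ys (λ y → sym (∑-distribʳ xs (μ y z) _)) ⟩
  ∑ ys (λ y → ∑ xs (λ x → α x * κ x y * μ y z))
    ≡⟨ ∑-comm ys xs _ ⟩
  ∑ xs (λ x → ∑ ys (λ y → α x * κ x y * μ y z))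
    ≡⟨ ∑-cong xs (λ x → ∑-cong ys (λ y → ℤP.*-assoc (α x) (κ x y) (μ y z))) ⟩
  ∑ xs (λ x → ∑ ys (λ y → α x * (κ x y * μ y z)))
    ≡⟨ ∑-cong xs (λ x → ∑-distribˡ ys (α x) _) ⟩
  ∑ xs (λ x → α x * ∑ ys (λ y → κ x y * μ y z))
    ∎
  where
  open ≡-Reasoning
  xs : List A
  xs = elements {{EA}}
  ys : List B
  ys = elements {{EB}}

module _ {A B : Set} {{_ : Enumeration A}} {{_ : Enumeration B}} where

  -- The paper's ℤ^(f), with formal sums over the finite type A read as functions A → ℤ.
  push : (A → B) → (A → ℤ) → B → ℤ
  push f α = bind α (λ x → δ (f x))

  push-δ : ∀ (f : A → B) a → push f (δ a) ≗ δ (f a)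
  push-δ f a = bind-δ a (λ x → δ (f x))

  push-congˡ : ∀ {f g : A → B} (α : A → ℤ) → f ≗ g → push f α ≗ push g α
  push-congˡ α f≗g = bind-congʳ α (λ x _ y → cong (λ b → δ b y) (f≗g x))

  push-congʳ : ∀ (f : A → B) {α α′ : A → ℤ} → α ≗ α′ → push f α ≗ push f α′
  push-congʳ f = bind-congˡ (λ x → δ (f x))

  push-support : ∀ (f : A → B) α y → ¬ push f α y ≡ 0ℤ → ∃ λ x → ¬ α x ≡ 0ℤ × f x ≡ y
  push-support f α y push≢0 with bind-support α (λ x → δ (f x)) y push≢0
  ... | x , αx≢0 , δ≢0 = x , αx≢0 , δ-nonzero⇒≡ δ≢0

bind-push : ∀ {A B C : Set} {{_ : Enumeration A}} {{_ : Enumeration B}}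
            (f : A → B) (α : A → ℤ) (κ : B → C → ℤ) → bind (push f α) κ ≗ bind α (κ ∘ f)
bind-push f α κ z = trans (bind-assoc α (λ x → δ (f x)) κ z)
                          (bind-congʳ α (λ x _ → bind-δ (f x) κ) z)

pushRestrict≗push : ∀ {m m′} (E : Subset m) (α : PMap m m′ → ℤ) →
                    pushRestrict E α ≗ push (restrict E) α
pushRestrict≗push E α g = ∑-cong (allPMaps _ _) (λ h → if-≟-δ (restrict E h) g (α h))

restrict-⊆ : ∀ {m m′} {F G : Subset m} → F ⊆ G → (h : PMap m m′) →
             restrict F (restrict G h) ≡ restrict F h
restrict-⊆ {F = []}        {[]}        F⊆G []      = refl
restrict-⊆ {F = true ∷ F}  {true ∷ G}  F⊆G (x ∷ h) = cong (x ∷_) (restrict-⊆ (SubsetP.drop-∷-⊆ F⊆G) h)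
restrict-⊆ {F = true ∷ F}  {false ∷ G} F⊆G (x ∷ h) with () ← F⊆G here
restrict-⊆ {F = false ∷ F} {_ ∷ G}     F⊆G (x ∷ h) = cong (nothing ∷_) (restrict-⊆ (SubsetP.drop-∷-⊆ F⊆G) h)

restrict-compose : ∀ {a b c} (E : Subset a) (t : PMap b c) (s : PMap a b) →
                   restrict E (compose t s) ≡ compose t (restrict E s)
restrict-compose []          t []      = refl
restrict-compose (true ∷ E)  t (x ∷ s) = cong (_ ∷_) (restrict-compose E t s)
restrict-compose (false ∷ E) t (x ∷ s) = cong (_ ∷_) (restrict-compose E t s)

lookup-restrict-∈ : ∀ {m m′} {I : Subset m} (t : PMap m m′) {y} → y ∈ I →
                    lookup (restrict I t) y ≡ lookup t y
lookup-restrict-∈ {I = I} t {y} y∈I =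
  trans (VecP.lookup-zipWith _ y I t) (cong (if_then lookup t y else nothing) (VecP.[]=⇒lookup y∈I))

compose-restrict : ∀ {a b c} (I : Subset b) (t : PMap b c) (r : PMap a b) →
                   (∀ i {y} → lookup r i ≡ just y → y ∈ I) →
                   compose t r ≡ compose (restrict I t) r
compose-restrict I t []             _      = refl
compose-restrict I t (nothing ∷ r)  r⊆I = cong (nothing ∷_) (compose-restrict I t r (r⊆I ∘ Fin.suc))
compose-restrict I t (just y ∷ r)   r⊆I =
  cong₂ _∷_ (sym (lookup-restrict-∈ t (r⊆I Fin.zero refl))) (compose-restrict I t r (r⊆I ∘ Fin.suc))

singleton : ∀ {b} → Maybe (Fin b) → Subset b
singleton nothing  = ⊥
singleton (just y) = ⁅ y ⁆

∣singleton∣≤1 : ∀ {b} (x : Maybe (Fin b)) → ∣ singleton x ∣ ≤ 1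
∣singleton∣≤1 {b} nothing = ℕP.≤-trans (ℕP.≤-reflexive (SubsetP.∣⊥∣≡0 b)) z≤n
∣singleton∣≤1 (just y)    = ℕP.≤-reflexive (SubsetP.∣⁅x⁆∣≡1 y)

lookup-singleton : ∀ {b} (x : Maybe (Fin b)) y →
                   ⌊ MaybeP.≡-dec FinP._≟_ x (just y) ⌋ ≡ lookup (singleton x) y
lookup-singleton nothing  y = sym (VecP.lookup-replicate y false)
lookup-singleton (just z) y with z FinP.≟ y
... | yes refl = sym (VecP.[]=⇒lookup (SubsetP.x∈⁅x⁆ z))
... | no  z≢y  = sym (BoolP.¬-not (SubsetP.x≢y⇒x∉⁅y⁆ (z≢y ∘ sym) ∘ VecP.lookup⇒[]= y ⁅ z ⁆))

image-[] : ∀ {b} → image {0} {b} [] ≡ ⊥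
image-[] {zero}  = refl
image-[] {suc b} = cong (false ∷_) image-[]

image-∷ : ∀ {a b} (x : Maybe (Fin b)) (s : PMap a b) → image (x ∷ s) ≡ singleton x ∪ image s
image-∷ {a} {b} x s = begin
  image (x ∷ s)                             ≡⟨ VecP.tabulate-cong pointwise ⟩
  tabulate (lookup (singleton x ∪ image s)) ≡⟨ VecP.tabulate∘lookup _ ⟩
  singleton x ∪ image s                     ∎
  where
  open ≡-Reasoning
  hits : Fin b → Fin (suc a) → Bool
  hits y i = ⌊ MaybeP.≡-dec FinP._≟_ (lookup (x ∷ s) i) (just y) ⌋

  pointwise : ∀ y → or (List.map (hits y) (allFin (suc a))) ≡ lookup (singleton x ∪ image s) y
  pointwise y = begin
    hits y Fin.zero ∨ or (List.map (hits y) (List.tabulate Fin.suc))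
      ≡⟨ cong₂ _∨_ (lookup-singleton x y)
               (cong or (trans (ListP.map-tabulate Fin.suc (hits y))
                               (sym (ListP.map-tabulate id (hits y ∘ Fin.suc))))) ⟩
    lookup (singleton x) y ∨ or (List.map (hits y ∘ Fin.suc) (allFin a))
      ≡⟨ cong (lookup (singleton x) y ∨_) (sym (VecP.lookup∘tabulate _ y)) ⟩
    lookup (singleton x) y ∨ lookup (image s) y
      ≡⟨ sym (VecP.lookup-zipWith _∨_ y (singleton x) (image s)) ⟩
    lookup (singleton x ∪ image s) y ∎

∪-mono-⊆ : ∀ {n} {p p′ q q′ : Subset n} → p ⊆ p′ → q ⊆ q′ → p ∪ q ⊆ p′ ∪ q′
∪-mono-⊆ {p = p} {q = q} p⊆p′ q⊆q′ y∈p∪q with SubsetP.x∈p∪q⁻ p q y∈p∪q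
... | inj₁ y∈p = SubsetP.x∈p∪q⁺ (inj₁ (p⊆p′ y∈p))
... | inj₂ y∈q = SubsetP.x∈p∪q⁺ (inj₂ (q⊆q′ y∈q))

∣p∪q∣≤∣p∣+∣q∣ : ∀ {n} (p q : Subset n) → ∣ p ∪ q ∣ ≤ ∣ p ∣ ℕ.+ ∣ q ∣
∣p∪q∣≤∣p∣+∣q∣ []          []          = z≤n
∣p∪q∣≤∣p∣+∣q∣ (true ∷ p)  (y ∷ q)     =
  s≤s (ℕP.≤-trans (∣p∪q∣≤∣p∣+∣q∣ p q) (ℕP.+-monoʳ-≤ ∣ p ∣ (SubsetP.∣p∣≤∣x∷p∣ y q)))
∣p∪q∣≤∣p∣+∣q∣ (false ∷ p) (true ∷ q)  =
  subst (suc ∣ p ∪ q ∣ ≤_) (sym (ℕP.+-suc ∣ p ∣ ∣ q ∣)) (s≤s (∣p∪q∣≤∣p∣+∣q∣ p q))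
∣p∪q∣≤∣p∣+∣q∣ (false ∷ p) (false ∷ q) = ∣p∪q∣≤∣p∣+∣q∣ p q

∈-image : ∀ {a b} (r : PMap a b) i {y} → lookup r i ≡ just y → y ∈ image r
∈-image (x ∷ r) i {y} ri≡y rewrite image-∷ x r with i
... | Fin.zero  rewrite ri≡y = SubsetP.x∈p∪q⁺ (inj₁ (SubsetP.x∈⁅x⁆ y))
... | Fin.suc i = SubsetP.x∈p∪q⁺ (inj₂ (∈-image r i ri≡y))

image-restrict-⊆ : ∀ {a b} (E : Subset a) (s : PMap a b) → image (restrict E s) ⊆ image s
image-restrict-⊆ []      [] = id
image-restrict-⊆ (e ∷ E) (x ∷ s)
  rewrite image-∷ x s | image-∷ (if e then x else nothing) (restrict E s) =
  ∪-mono-⊆ (head e) (image-restrict-⊆ E s)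
  where
  head : ∀ e → singleton (if e then x else nothing) ⊆ singleton x
  head true  = id
  head false = SubsetP.⊆-min _

∣image∣≤∣dom∣ : ∀ {a b} (D : Subset a) (s : PMap a b) → HasDom D s → ∣ image s ∣ ≤ ∣ D ∣
∣image∣≤∣dom∣ {b = b} [] [] _ = ℕP.≤-reflexive (trans (cong ∣_∣ (image-[] {b})) (SubsetP.∣⊥∣≡0 b))
∣image∣≤∣dom∣ {b = b} (d ∷ D) (x ∷ s) dom rewrite image-∷ x s =
  ℕP.≤-trans (∣p∪q∣≤∣p∣+∣q∣ (singleton x) (image s)) (head d (proj₂ (dom Fin.zero)))
  where
  tail : HasDom D s
  tail i = (λ i∈D → proj₁ (dom (Fin.suc i)) (there i∈D))
         , (λ i∉D → proj₂ (dom (Fin.suc i)) (i∉D ∘ SubsetP.drop-there))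
  ih : ∣ image s ∣ ≤ ∣ D ∣
  ih = ∣image∣≤∣dom∣ D s tail
  head : ∀ d → (Fin.zero ∉ d ∷ D → x ≡ nothing) → ∣ singleton x ∣ ℕ.+ ∣ image s ∣ ≤ ∣ d ∷ D ∣
  head true  _       = ℕP.+-mono-≤ (∣singleton∣≤1 x) ih
  head false x≡nothing rewrite x≡nothing (λ ()) =
    subst (λ n → n ℕ.+ ∣ image s ∣ ≤ ∣ D ∣) (sym (SubsetP.∣⊥∣≡0 b)) ih

⊆-∣∣-antisym : ∀ {n} {p q : Subset n} → p ⊆ q → ∣ q ∣ ≤ ∣ p ∣ → q ≡ p
⊆-∣∣-antisym {p = []}        {[]}        _   _         = refl
⊆-∣∣-antisym {p = true ∷ p}  {true ∷ q}  p⊆q (s≤s q≤p) = cong (true ∷_) (⊆-∣∣-antisym (SubsetP.drop-∷-⊆ p⊆q) q≤p)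
⊆-∣∣-antisym {p = true ∷ p}  {false ∷ q} p⊆q _         with () ← p⊆q here
⊆-∣∣-antisym {p = false ∷ p} {true ∷ q}  p⊆q q≤p       =
  ⊥-elim (ℕP.<-irrefl refl (ℕP.≤-trans q≤p (SubsetP.p⊆q⇒∣p∣≤∣q∣ (SubsetP.drop-∷-⊆ p⊆q))))
⊆-∣∣-antisym {p = false ∷ p} {false ∷ q} p⊆q q≤p       = cong (false ∷_) (⊆-∣∣-antisym (SubsetP.drop-∷-⊆ p⊆q) q≤p)

IsMaxₖ-intro : ∀ {n} k {D : Subset n} → ∣ D ∣ ≤ k → k ≤ ∣ D ∣ ⊎ D ≡ ⊤ → IsMaxₖ k D
IsMaxₖ-intro k {D} D≤k full = D≤k , maximal full
  where
  maximal : k ≤ ∣ D ∣ ⊎ D ≡ ⊤ → ∀ E → ∣ E ∣ ≤ k → D ⊆ E → E ≡ D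
  maximal (inj₁ k≤D)  E E≤k D⊆E = ⊆-∣∣-antisym D⊆E (ℕP.≤-trans E≤k k≤D)
  maximal (inj₂ refl) E E≤k D⊆E = SubsetP.⊆-antisym SubsetP.⊆⊤ D⊆E

fill : ∀ {n} → ℕ → Subset n → Subset n
fill r       []          = []
fill r       (true ∷ p)  = true ∷ fill r p
fill zero    (false ∷ p) = false ∷ p
fill (suc r) (false ∷ p) = true ∷ fill r p

⊆-fill : ∀ {n} r (p : Subset n) → p ⊆ fill r p
⊆-fill r       (true ∷ p)  here       = here
⊆-fill r       (true ∷ p)  (there x∈p) = there (⊆-fill r p x∈p)
⊆-fill zero    (false ∷ p) x∈p        = x∈p
⊆-fill (suc r) (false ∷ p) (there x∈p) = there (⊆-fill r p x∈p)

∣fill∣≤ : ∀ {n} r (p : Subset n) → ∣ fill r p ∣ ≤ ∣ p ∣ ℕ.+ r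
∣fill∣≤ r       []          = z≤n
∣fill∣≤ r       (true ∷ p)  = s≤s (∣fill∣≤ r p)
∣fill∣≤ zero    (false ∷ p) = ℕP.m≤m+n ∣ p ∣ 0
∣fill∣≤ (suc r) (false ∷ p) = subst (suc ∣ fill r p ∣ ≤_) (sym (ℕP.+-suc ∣ p ∣ r)) (s≤s (∣fill∣≤ r p))

fill-full : ∀ {n} r (p : Subset n) → ∣ p ∣ ℕ.+ r ≤ ∣ fill r p ∣ ⊎ fill r p ≡ ⊤
fill-full r       []          = inj₂ refl
fill-full r       (true ∷ p)  with fill-full r p
... | inj₁ p+r≤ = inj₁ (s≤s p+r≤)
... | inj₂ full = inj₂ (cong (true ∷_) full)
fill-full zero    (false ∷ p) = inj₁ (ℕP.≤-reflexive (ℕP.+-identityʳ ∣ p ∣))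
fill-full (suc r) (false ∷ p) with fill-full r p
... | inj₁ p+r≤ = inj₁ (subst (_≤ suc ∣ fill r p ∣) (sym (ℕP.+-suc ∣ p ∣ r)) (s≤s p+r≤))
... | inj₂ full = inj₂ (cong (true ∷_) full)

extend : ∀ {n} → ℕ → Subset n → Subset n
extend k F = fill (k ∸ ∣ F ∣) F

⊆-extend : ∀ {n} k (F : Subset n) → F ⊆ extend k F
⊆-extend k F = ⊆-fill (k ∸ ∣ F ∣) F

extend-maximal : ∀ {n} k {F : Subset n} → ∣ F ∣ ≤ k → IsMaxₖ k (extend k F)
extend-maximal k {F} F≤k = IsMaxₖ-intro k ≤k full
  where
  F+[k∸F]≡k : ∣ F ∣ ℕ.+ (k ∸ ∣ F ∣) ≡ k
  F+[k∸F]≡k = ℕP.m+[n∸m]≡n F≤k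
  ≤k : ∣ extend k F ∣ ≤ k
  ≤k = subst (∣ extend k F ∣ ≤_) F+[k∸F]≡k (∣fill∣≤ (k ∸ ∣ F ∣) F)
  full : k ≤ ∣ extend k F ∣ ⊎ extend k F ≡ ⊤
  full with fill-full (k ∸ ∣ F ∣) F
  ... | inj₁ ≥k   = inj₁ (subst (_≤ ∣ extend k F ∣) F+[k∸F]≡k ≥k)
  ... | inj₂ full = inj₂ full

-- The first two clauses of ZTest, spelled identically so that witnesses convert.
Compatible : ∀ {m m′} → ℕ → (Subset m → PMap m m′ → ℤ) → Set
Compatible k α = ∀ D D′ → IsMaxₖ k D → IsMaxₖ k D′ → ∀ g →
                 pushRestrict (D ∩ D′) (α D) g ≡ pushRestrict (D ∩ D′) (α D′) g

SupportedIn : ∀ {σ} (k : ℕ) (X Y : Struct σ) → Family X Y →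
              (Subset (size X) → PMap (size X) (size Y) → ℤ) → Set
SupportedIn k X Y P α = ∀ D → IsMaxₖ k D → ∀ h → ¬ (α D h ≡ 0ℤ) → P D h

push-restrict-⊆ : ∀ {m m′} {F G : Subset m} → F ⊆ G → (α : PMap m m′ → ℤ) →
                  push (restrict F) (push (restrict G) α) ≗ push (restrict F) α
push-restrict-⊆ {F = F} {G} F⊆G α g =
  trans (bind-push (restrict G) α (λ h → δ (restrict F h)) g)
        (push-congˡ α (restrict-⊆ F⊆G) g)

compatible-push : ∀ {m m′ k} {β : Subset m → PMap m m′ → ℤ} → Compatible k β →
                  ∀ {D D′} → IsMaxₖ k D → IsMaxₖ k D′ →
                  push (restrict (D ∩ D′)) (β D) ≗ push (restrict (D ∩ D′)) (β D′)
compatible-push {β = β} β-compatible {D} {D′} D-max D′-max h = begin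
  push (restrict (D ∩ D′)) (β D) h  ≡⟨ pushRestrict≗push (D ∩ D′) (β D) h ⟨
  pushRestrict (D ∩ D′) (β D) h     ≡⟨ β-compatible D D′ D-max D′-max h ⟩
  pushRestrict (D ∩ D′) (β D′) h    ≡⟨ pushRestrict≗push (D ∩ D′) (β D′) h ⟩
  push (restrict (D ∩ D′)) (β D′) h ∎
  where open ≡-Reasoning

module CompatibleFamily {m m′} (k : ℕ) (β : Subset m → PMap m m′ → ℤ)
                        (β-compatible : Compatible k β) where

  push-restrict-independent : ∀ {F D D′} → IsMaxₖ k D → IsMaxₖ k D′ → F ⊆ D → F ⊆ D′ →
                              push (restrict F) (β D) ≗ push (restrict F) (β D′)
  push-restrict-independent {F} {D} {D′} D-max D′-max F⊆D F⊆D′ g = begin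
    push (restrict F) (β D) g                          ≡⟨ push-restrict-⊆ F⊆D∩D′ (β D) g ⟨
    push (restrict F) (push (restrict (D ∩ D′)) (β D)) g  ≡⟨ push-congʳ (restrict F) (compatible-push β-compatible D-max D′-max) g ⟩
    push (restrict F) (push (restrict (D ∩ D′)) (β D′)) g ≡⟨ push-restrict-⊆ F⊆D∩D′ (β D′) g ⟩
    push (restrict F) (β D′) g                         ∎
    where
    open ≡-Reasoning
    F⊆D∩D′ : F ⊆ D ∩ D′
    F⊆D∩D′ x∈F = SubsetP.x∈p∩q⁺ (F⊆D x∈F , F⊆D′ x∈F)

  β̂ : Subset m → PMap m m′ → ℤ
  β̂ F = push (restrict F) (β (extend k F))

  β̂-maximal : ∀ {F D} → IsMaxₖ k D → F ⊆ D → β̂ F ≗ push (restrict F) (β D)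
  β̂-maximal {F} {D} D-max@(D≤k , _) F⊆D =
    push-restrict-independent (extend-maximal k F≤k) D-max (⊆-extend k F) F⊆D
    where
    F≤k : ∣ F ∣ ≤ k
    F≤k = ℕP.≤-trans (SubsetP.p⊆q⇒∣p∣≤∣q∣ F⊆D) D≤k

  β̂-restrict : ∀ {F G} → F ⊆ G → ∣ G ∣ ≤ k → push (restrict F) (β̂ G) ≗ β̂ F
  β̂-restrict {F} {G} F⊆G G≤k g = begin
    push (restrict F) (β̂ G) g          ≡⟨ push-restrict-⊆ F⊆G (β (extend k G)) g ⟩
    push (restrict F) (β (extend k G)) g ≡⟨ β̂-maximal G-max (SubsetP.⊆-trans F⊆G (⊆-extend k G)) g ⟨
    β̂ F g                              ∎
    where
    open ≡-Reasoning
    G-max : IsMaxₖ k (extend k G)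
    G-max = extend-maximal k G≤k

∣image∣≤k : ∀ {σ k} {X Y : Struct σ} {P : Family X Y} → IsSubpresheaf k X Y P →
            ∀ {D s} → P D s → ∣ image s ∣ ≤ k
∣image∣≤k (P-hom , _) {D} {s} s∈P =
  ℕP.≤-trans (∣image∣≤∣dom∣ D s (proj₁ (proj₂ (P-hom D s s∈P)))) (proj₁ (P-hom D s s∈P))

module CompositeWitness {σ} {A B C : Struct σ} (k : ℕ) {S : Family A B} {T : Family B C}
  (S-sub : IsSubpresheaf k A B S) (T-sub : IsSubpresheaf k B C T)
  (α : Subset (size A) → PMap (size A) (size B) → ℤ)
  (α-supported : SupportedIn k A B S α) (α-compatible : Compatible k α)
  (β : Subset (size B) → PMap (size B) (size C) → ℤ)
  (β-supported : SupportedIn k B C T β) (β-compatible : Compatible k β) where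

  open CompatibleFamily k β β-compatible

  κ : PMap (size A) (size B) → PMap (size A) (size C) → ℤ
  κ s = push (λ t → compose t s) (β̂ (image s))

  γ : Subset (size A) → PMap (size A) (size C) → ℤ
  γ D = bind (α D) κ

  κ-restrict : ∀ E s → ∣ image s ∣ ≤ k → push (restrict E) (κ s) ≗ κ (restrict E s)
  κ-restrict E s s≤k g = begin
    push (restrict E) (κ s) g
      ≡⟨ bind-push (λ t → compose t s) (β̂ (image s)) (λ h → δ (restrict E h)) g ⟩
    push (λ t → restrict E (compose t s)) (β̂ (image s)) g
      ≡⟨ push-congˡ (β̂ (image s)) restrict-∘ g ⟩
    push (λ t → compose (restrict (image r) t) r) (β̂ (image s)) g
      ≡⟨ bind-push (restrict (image r)) (β̂ (image s)) (λ u → δ (compose u r)) g ⟨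
    push (λ u → compose u r) (push (restrict (image r)) (β̂ (image s))) g
      ≡⟨ push-congʳ (λ u → compose u r) (β̂-restrict (image-restrict-⊆ E s) s≤k) g ⟩
    κ r g ∎
    where
    open ≡-Reasoning
    r : PMap (size A) (size B)
    r = restrict E s
    restrict-∘ : ∀ t → restrict E (compose t s) ≡ compose (restrict (image r) t) r
    restrict-∘ t = trans (restrict-compose E t s) (compose-restrict (image r) t r (∈-image r))

  push-restrict-γ : ∀ {D} → IsMaxₖ k D → ∀ E → push (restrict E) (γ D) ≗ bind (push (restrict E) (α D)) κ
  push-restrict-γ {D} D-max E g = begin
    push (restrict E) (γ D) g
      ≡⟨ bind-assoc (α D) κ (λ h → δ (restrict E h)) g ⟩
    bind (α D) (λ s → push (restrict E) (κ s)) g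
      ≡⟨ bind-congʳ (α D) κ-restrict-on-support g ⟩
    bind (α D) (κ ∘ restrict E) g
      ≡⟨ bind-push (restrict E) (α D) κ g ⟨
    bind (push (restrict E) (α D)) κ g ∎
    where
    open ≡-Reasoning
    κ-restrict-on-support : ∀ s → ¬ α D s ≡ 0ℤ → push (restrict E) (κ s) ≗ κ (restrict E s)
    κ-restrict-on-support s αs≢0 = κ-restrict E s (∣image∣≤k S-sub (α-supported D D-max s αs≢0))

  γ-compatible : Compatible k γ
  γ-compatible D D′ D-max D′-max g = begin
    pushRestrict (D ∩ D′) (γ D) g                  ≡⟨ pushRestrict≗push (D ∩ D′) (γ D) g ⟩
    push (restrict (D ∩ D′)) (γ D) g               ≡⟨ push-restrict-γ D-max (D ∩ D′) g ⟩
    bind (push (restrict (D ∩ D′)) (α D)) κ g      ≡⟨ bind-congˡ κ (compatible-push α-compatible D-max D′-max) g ⟩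
    bind (push (restrict (D ∩ D′)) (α D′)) κ g     ≡⟨ push-restrict-γ D′-max (D ∩ D′) g ⟨
    push (restrict (D ∩ D′)) (γ D′) g              ≡⟨ pushRestrict≗push (D ∩ D′) (γ D′) g ⟨
    pushRestrict (D ∩ D′) (γ D′) g                 ∎
    where open ≡-Reasoning

  γ-supported : SupportedIn k A C (Comp {A = A} {B} {C} T S) γ
  γ-supported D D-max h γ≢0
    with s , αs≢0 , κs≢0 ← bind-support (α D) κ h γ≢0
    with t , β̂t≢0 , t∘s≡h ← push-support (λ t → compose t s) (β̂ (image s)) h κs≢0
    with w , βw≢0 , w↾≡t ← push-support (restrict (image s)) (β (extend k (image s))) t β̂t≢0
    = s , t , s∈S , t∈T , sym t∘s≡h
    where
    s∈S : S D s
    s∈S = α-supported D D-max s αs≢0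
    w∈T : T (extend k (image s)) w
    w∈T = β-supported _ (extend-maximal k (∣image∣≤k S-sub s∈S)) w βw≢0
    t∈T : T (image s) t
    t∈T = subst (T (image s)) w↾≡t (proj₂ T-sub _ (image s) w (⊆-extend k (image s)) w∈T)

  γ-unit : ∀ {U s D t′} → α U ≗ δ s → IsMaxₖ k D → image s ⊆ D → β D ≗ δ t′ →
           γ U ≗ δ (compose (restrict (image s) t′) s)
  γ-unit {U} {s} {D} {t′} α≗δ D-max s⊆D β≗δ h = begin
    bind (α U) κ h
      ≡⟨ bind-congˡ κ α≗δ h ⟩
    bind (δ s) κ h
      ≡⟨ bind-δ s κ h ⟩
    push compose-s (β̂ (image s)) h
      ≡⟨ push-congʳ compose-s (β̂-maximal D-max s⊆D) h ⟩
    push compose-s (push (restrict (image s)) (β D)) h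
      ≡⟨ push-congʳ compose-s (push-congʳ (restrict (image s)) β≗δ) h ⟩
    push compose-s (push (restrict (image s)) (δ t′)) h
      ≡⟨ push-congʳ compose-s (push-δ (restrict (image s)) t′) h ⟩
    push compose-s (δ (restrict (image s) t′)) h
      ≡⟨ push-δ compose-s (restrict (image s) t′) h ⟩
    δ (compose (restrict (image s) t′) s) h ∎
    where
    open ≡-Reasoning
    compose-s : PMap (size B) (size C) → PMap (size A) (size C)
    compose-s t = compose t s

ZTest-compose : ∀ {σ k} {A B C : Struct σ} {S : Family A B} {T : Family B C} →
                IsSubpresheaf k A B S → IsSubpresheaf k B C T →
                ∀ {U s D t′} → ZTest k A B S U s → IsMaxₖ k D → ZTest k B C T D t′ → image s ⊆ D →
                ZTest k A C (Comp {A = A} {B} {C} T S) U (compose (restrict (image s) t′) s)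
ZTest-compose {k = k} S-sub T-sub {U} {s} {D} {t′}
  (α , α-supported , α-compatible , α-unit) D-max (β , β-supported , β-compatible , β-unit) s⊆D =
  γ , γ-supported , γ-compatible ,
  ≗-δ⇒IsUnitAt (γ-unit (IsUnitAt⇒≗-δ (α U) α-unit) D-max s⊆D (IsUnitAt⇒≗-δ (β D) β-unit))
  where open CompositeWitness k S-sub T-sub α α-supported α-compatible β β-supported β-compatible

proposition10p3 : (σ : Vocab) (A B C : Struct σ) (k : ℕ) → 1 ≤ k →
    (S : Family A B) (T : Family B C) →
    IsSubpresheaf k A B S → IsFlasque k A B S →
    IsSubpresheaf k B C T → IsFlasque k B C T →
    SameFamily A B (Box k A B S) S → SameFamily B C (Box k B C T) T →
    SameFamily A C (Box k A C (Comp {A = A} {B} {C} T S)) (Comp {A = A} {B} {C} T S)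
proposition10p3 σ A B C k _ S T S-sub _ T-sub T-flasque S□≡S T□≡T U h =
  proj₁ , λ h∈T∘S → h∈T∘S , passes h∈T∘S
  where
  T∘S : Family A C
  T∘S = Comp {A = A} {B} {C} T S

  passes : ∀ {h} → T∘S U h → IsMaxₖ k U → ZTest k A C T∘S U h
  passes (s , t , s∈S , t∈T , refl) U-max =
    let t′ , t′∈T , t′↾≡t = T-flasque D (image s) (proj₁ D-max) (⊆-extend k (image s)) t t∈T
        t′-test = proj₂ (proj₂ (T□≡T D t′) t′∈T) D-max
    in subst (λ t → ZTest k A C T∘S U (compose t s)) t′↾≡t
         (ZTest-compose S-sub T-sub s-test D-max t′-test (⊆-extend k (image s)))
    where
    D : Subset (size B)
    D = extend k (image s)
    D-max : IsMaxₖ k D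
    D-max = extend-maximal k (∣image∣≤k S-sub s∈S)
    s-test : ZTest k A B S U s
    s-test = proj₂ (proj₂ (S□≡S U s) s∈S) U-max
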